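{- Let $\mathcal{I} = (G,\mathcal{T},(A^\circ,B^\circ),k)$ be a Terminal Separation instance in which $(A^\circ,B^\circ)$ is maximal. Let $G'$ be obtained from $G$ either (i) by deleting one edge $ab$ with $a\in A^\circ$, $b\in B^\circ$, or (ii) by deleting two edges $va, vb$ where $a\in A^\circ$, $b\in B^\circ$ and $v\notin A^\circ\cup B^\circ$. Then $\mathcal{I}' = (G',\mathcal{T},(A^\circ,B^\circ),k-1)$ is a Terminal Separation instance in which $(A^\circ,B^\circ)$ is maximal, $\mathcal{I}'$ is equivalent to $\mathcal{I}$ (one has an integral terminal separation extending $(A^\circ,B^\circ)$ of cost at most its budget iff the other does), and $\mu_{\mathcal{I}'} = \mu_\mathcal{I} - \alpha_k$.
   Context: Graphs may have multiple edges but no loops; $d(A)$ is the number of edges with exactly one endpoint in $A$. A terminal separation for a family $\mathcal{T}$ of terminal pairs is a pair $(A,B)$ of disjoint vertex sets such that every pair of $\mathcal{T}$ either has one terminal in $A$ and the other in $B$, or is disjoint from $A\cup B$; it is integral if $A\cup B=V(G)$; $(A',B')$ extends $(A,B)$ if $A\subseteq A'$, $B\subseteq B'$; cost $c(A,B)=(d(A)+d(B))/2$. A Terminal Separation instance $(G,\mathcal{T},(A^\circ,B^\circ),k)$ consists of a graph, pairwise disjoint terminal pairs with all terminals of degree at most one, a terminal separation $(A^\circ,B^\circ)$ and an integer budget $k$. $(A^\circ,B^\circ)$ is maximal if every other terminal separation extending it has strictly larger cost. The potential is $\mu_\mathcal{I} = \alpha_t t_\mathcal{I} + \alpha_\nu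 (k - c(A^\circ,B^\circ)) + \alpha_k k$, where $t_\mathcal{I}$ is the number of terminal pairs disjoint from $A^\circ\cup B^\circ$, and $\alpha_t = 0.59950$, $\alpha_\nu = 0.29774$, $\alpha_k = 0.10276$. -}

module Defs where

import Data.Nat
open import Data.Nat using (ℕ)
open import Data.Integer using (ℤ; +_) renaming (_-_ to _-ℤ_)
open import Data.Rational using (ℚ; _/_; _+_; _*_; _-_; _<_; _≤_)
open import Data.Fin using (Fin)
open import Data.Fin.Subset using (Subset; _∈_; _∉_; _⊆_)
open import Data.Fin.Subset.Properties using (_∈?_)
import Data.Bool
import Data.Fin
import Data.Product
open import Data.Bool using (Bool; true; false; _xor_; _∨_)
open import Data.List using (List; []; _∷_; length; filter; concatMap)
open import Data.List.Relation.Unary.All using (All)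
open import Data.List.Relation.Unary.Unique.Propositional using (Unique)
open import Data.List.Relation.Binary.Permutation.Propositional using (_↭_)
open import Data.Product using (_×_; _,_; proj₁; proj₂; ∃₂)
open import Data.Sum using (_⊎_)
open import Relation.Binary.PropositionalEquality using (_≡_; _≢_)
open import Relation.Nullary using (¬_)
open import Relation.Nullary.Decidable using (does; ⌊_⌋)
open import Function.Bundles using (_⇔_)

-- Multigraph on vertex set Fin n: a list of edges (a multiset of unordered
-- pairs, each stored as an ordered pair in some orientation), no loops.
Edge : ℕ → Set
Edge n = Fin n × Fin n

record Graph (n : ℕ) : Set where
  field
    edges   : List (Edge n)
    noLoops : All (λ e → proj₁ e ≢ proj₂ e) edges
open Graph public

inB : ∀ {n} → Fin n → Subset n → Bool
inB x A = does (x ∈? A)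

countB : ∀ {A : Set} → (A → Bool) → List A → ℕ
countB p [] = 0
countB p (x ∷ xs) with p x
... | true  = Data.Nat.suc (countB p xs)
... | false = countB p xs

d : ∀ {n} → Graph n → Subset n → ℕ
d G A = countB (λ e → inB (proj₁ e) A xor inB (proj₂ e) A) (edges G)

deg : ∀ {n} → Graph n → Fin n → ℕ
deg G v = countB (λ e → does (proj₁ e Data.Fin.≟ v) ∨ does (proj₂ e Data.Fin.≟ v)) (edges G)

Pair : ℕ → Set
Pair n = Fin n × Fin n

terminals : ∀ {n} → List (Pair n) → List (Fin n)
terminals = concatMap (λ p → proj₁ p ∷ proj₂ p ∷ [])

cost : ∀ {n} → Graph n → Subset n → Subset n → ℚ
cost G A B = (+ (d G A Data.Nat.+ d G B)) / 2

Disjoint : ∀ {n} → Subset n → Subset n → Set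
Disjoint A B = ∀ x → x ∈ A → x ∉ B

PairOutside : ∀ {n} → Subset n → Subset n → Pair n → Set
PairOutside A B (s , t) = (s ∉ A × s ∉ B) × (t ∉ A × t ∉ B)

PairSeparated : ∀ {n} → Subset n → Subset n → Pair n → Set
PairSeparated A B (s , t) = (s ∈ A × t ∈ B) ⊎ (s ∈ B × t ∈ A)

IsTermSep : ∀ {n} → List (Pair n) → Subset n → Subset n → Set
IsTermSep T A B = Disjoint A B × All (λ p → PairSeparated A B p ⊎ PairOutside A B p) T

Integral : ∀ {n} → Subset n → Subset n → Set
Integral A B = ∀ x → x ∈ A ⊎ x ∈ B

Extends : ∀ {n} → (A' B' A B : Subset n) → Set
Extends A' B' A B = A ⊆ A' × B ⊆ B'

record IsInstance {n : ℕ} (G : Graph n) (T : List (Pair n)) (A B : Subset n) (k : ℤ) : Set where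
  field
    pairsDisjoint : Unique (terminals T)
    termDeg       : All (λ v → deg G v Data.Nat.≤ 1) (terminals T)
    sep           : IsTermSep T A B

Maximal : ∀ {n} → Graph n → List (Pair n) → Subset n → Subset n → Set
Maximal G T A B = ∀ A' B' → IsTermSep T A' B' → Extends A' B' A B →
  ¬ (A' ≡ A × B' ≡ B) → cost G A B < cost G A' B'

Solvable : ∀ {n} → Graph n → List (Pair n) → Subset n → Subset n → ℤ → Set
Solvable G T A B k = ∃₂ λ A' B' → IsTermSep T A' B' × Integral A' B' ×
  Extends A' B' A B × cost G A' B' ≤ (k / 1)

tI : ∀ {n} → List (Pair n) → Subset n → Subset n → ℕ
tI T A B = countB (λ p → Data.Bool.not (inB (proj₁ p) A ∨ inB (proj₁ p) B ∨
                                        inB (proj₂ p) A ∨ inB (proj₂ p) B)) T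

αt αν αk : ℚ
αt = + 59950 / 100000
αν = + 29774 / 100000
αk = + 10276 / 100000

μ : ∀ {n} → Graph n → List (Pair n) → Subset n → Subset n → ℤ → ℚ
μ G T A B k = αt * (+ tI T A B / 1) + αν * ((k / 1) - cost G A B) + αk * (k / 1)

-- G' is obtained from G by deleting one copy of the edge {u,w}
-- (as multisets of unordered edges: E ≈ {u,w} ∷ E')
DelEdge : ∀ {n} → Fin n → Fin n → List (Edge n) → List (Edge n) → Set
DelEdge u w E E' = E ↭ ((u , w) ∷ E') ⊎ E ↭ ((w , u) ∷ E')

DeletionStep : ∀ {n} → Graph n → Subset n → Subset n → Graph n → Set
DeletionStep G A B G' =
    (∃₂ λ a b → a ∈ A × b ∈ B × DelEdge a b (edges G) (edges G'))
  ⊎ (∃₂ λ a b → Data.Product.∃ λ v → a ∈ A × b ∈ B × v ∉ A × v ∉ B ×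
       Data.Product.∃ λ E₁ → DelEdge v a (edges G) E₁ × DelEdge v b E₁ (edges G'))

-- The deleted edges form a path of length one or two from some a ∈ A° to some b ∈ B°.
-- For disjoint X ⊇ A°, Y ⊇ B° such a path crosses the cut of X exactly once and the cut
-- of Y exactly once, so d(X) + d(Y) drops by exactly 2: every terminal separation
-- extending (A°, B°) becomes exactly 1 cheaper. Lowering the budget by 1 therefore
-- preserves solvability and the cost comparisons behind maximality, and k − c(A°, B°)
-- is unchanged, so μ drops by α_k.
module Submission where

open import Defs
open import Data.Nat using (ℕ)
open import Data.Integer using (ℤ; +_; _-_)
open import Data.Fin.Subset using (Subset)
open import Data.List using (List)
open import Data.Product using (_×_)
open import Function.Bundles using (_⇔_)
open import Relation.Binary.PropositionalEquality using (_≡_)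
import Data.Rational

open import Data.Bool using (Bool; true; false; _xor_; T?)
open import Data.Bool.Properties using (xor-comm; not-involutive)
open import Data.Fin using (Fin)
open import Data.Fin.Subset using (_∈_; _∉_)
open import Data.Fin.Subset.Properties using (_∈?_; ⊆-refl)
import Data.Integer as ℤ
open import Data.Integer.Properties using (pos-+)
open import Data.Integer.Tactic.RingSolver using (solve-∀)
open import Data.List using ([]; _∷_; length; filter)
open import Data.List.Relation.Binary.Permutation.Propositional using (_↭_)
open import Data.List.Relation.Binary.Permutation.Propositional.Properties using (↭-length; filter-↭)
open import Data.List.Relation.Unary.All as All using ()
open import Data.Nat as ℕ using (suc; _≤_)
open import Data.Nat.Properties using (≤-refl; ≤-trans; ≤-reflexive; m≤n⇒m≤1+n; +-suc)
open import Data.Product using (_,_; proj₁; ∃₂)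
open import Data.Rational as ℚ using (1ℚ; _/_; fromℚᵘ; toℚᵘ)
open import Data.Rational.Properties using (toℚᵘ-injective; toℚᵘ-fromℚᵘ; toℚᵘ-homo-+; fromℚᵘ-cong; +-monoˡ-<; +-monoˡ-≤)
open import Data.Rational.Unnormalised as ℚᵘ using (mkℚᵘ; *≡*)
import Data.Rational.Unnormalised.Properties as ℚᵘ
import Data.Rational.Solver as ℚ-Solver
open import Data.Sum using (_⊎_; inj₁; inj₂; [_,_])
open import Function.Bundles using (mk⇔; module Equivalence)
open import Relation.Binary.PropositionalEquality using (refl; sym; trans; cong; cong₂; subst₂; module ≡-Reasoning)
open import Relation.Nullary.Decidable using (dec-true; dec-false)

countB≡length∘filter : ∀ {A : Set} (p : A → Bool) xs →
  countB p xs ≡ length (filter (λ x → T? (p x)) xs)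
countB≡length∘filter p [] = refl
countB≡length∘filter p (x ∷ xs) with p x
... | true  = cong suc (countB≡length∘filter p xs)
... | false = countB≡length∘filter p xs

countB-↭ : ∀ {A : Set} (p : A → Bool) {xs ys} → xs ↭ ys → countB p xs ≡ countB p ys
countB-↭ p {xs} {ys} xs↭ys = begin
  countB p xs                          ≡⟨ countB≡length∘filter p xs ⟩
  length (filter (λ x → T? (p x)) xs)  ≡⟨ ↭-length (filter-↭ (λ x → T? (p x)) xs↭ys) ⟩
  length (filter (λ x → T? (p x)) ys)  ≡⟨ countB≡length∘filter p ys ⟨
  countB p ys                          ∎
  where open ≡-Reasoning

countB-∷-true : ∀ {A : Set} (p : A → Bool) x xs → p x ≡ true → countB p (x ∷ xs) ≡ suc (countB p xs)
countB-∷-true p x xs px with p x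
countB-∷-true p x xs refl | true = refl

countB-∷-false : ∀ {A : Set} (p : A → Bool) x xs → p x ≡ false → countB p (x ∷ xs) ≡ countB p xs
countB-∷-false p x xs px with p x
countB-∷-false p x xs refl | false = refl

countB-∷-congˡ : ∀ {A : Set} (p : A → Bool) {x y} xs → p x ≡ p y → countB p (x ∷ xs) ≡ countB p (y ∷ xs)
countB-∷-congˡ p {x} {y} xs px≡py with p x | p y
countB-∷-congˡ p xs refl | true  | true  = refl
countB-∷-congˡ p xs refl | false | false = refl

countB-∷-congʳ : ∀ {A : Set} (p : A → Bool) x {xs ys} → countB p xs ≡ countB p ys →
  countB p (x ∷ xs) ≡ countB p (x ∷ ys)
countB-∷-congʳ p x eq with p x
... | true  = cong suc eq
... | false = eq

countB-≤-∷ : ∀ {A : Set} (p : A → Bool) x xs → countB p xs ≤ countB p (x ∷ xs)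
countB-≤-∷ p x xs with p x
... | true  = m≤n⇒m≤1+n ≤-refl
... | false = ≤-refl

countB-delEdge : ∀ {n} (p : Edge n → Bool) → (∀ u w → p (u , w) ≡ p (w , u)) →
  ∀ u w {E E'} → DelEdge u w E E' → countB p E ≡ countB p ((u , w) ∷ E')
countB-delEdge p p-sym u w (inj₁ E↭uwE') = countB-↭ p E↭uwE'
countB-delEdge p p-sym u w {E' = E'} (inj₂ E↭wuE') =
  trans (countB-↭ p E↭wuE') (countB-∷-congˡ p E' (p-sym w u))

countB-↭-∷-≤ : ∀ {A : Set} (p : A → Bool) {x xs ys} → xs ↭ x ∷ ys → countB p ys ≤ countB p xs
countB-↭-∷-≤ p xs↭x∷ys = ≤-trans (countB-≤-∷ p _ _) (≤-reflexive (sym (countB-↭ p xs↭x∷ys)))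

countB-delEdge-≤ : ∀ {n} (p : Edge n → Bool) {u w E E'} → DelEdge u w E E' → countB p E' ≤ countB p E
countB-delEdge-≤ p = [ countB-↭-∷-≤ p , countB-↭-∷-≤ p ]

crosses : ∀ {n} → Subset n → Edge n → Bool
crosses X (u , w) = inB u X xor inB w X

crosses-sym : ∀ {n} (X : Subset n) u w → crosses X (u , w) ≡ crosses X (w , u)
crosses-sym X u w = xor-comm (inB u X) (inB w X)

∈∉⇒crosses : ∀ {n} {X : Subset n} {a b} → a ∈ X → b ∉ X → crosses X (a , b) ≡ true
∈∉⇒crosses {X = X} {a} {b} a∈X b∉X = cong₂ _xor_ (dec-true (a ∈? X) a∈X) (dec-false (b ∈? X) b∉X)

xor-cancelˡ : ∀ s x y → (s xor x) xor (s xor y) ≡ x xor y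
xor-cancelˡ false x     y = refl
xor-cancelˡ true  true  y = refl
xor-cancelˡ true  false y = not-involutive y

countB-∷-∷-xor : ∀ {A : Set} (p : A → Bool) x y xs → p x xor p y ≡ true →
  countB p (x ∷ y ∷ xs) ≡ suc (countB p xs)
countB-∷-∷-xor p x y xs odd = by-cases (p x) (p y) refl refl odd
  where
  by-cases : ∀ bx by → p x ≡ bx → p y ≡ by → bx xor by ≡ true →
    countB p (x ∷ y ∷ xs) ≡ suc (countB p xs)
  by-cases true  false px py _ = trans (countB-∷-true p x _ px) (cong suc (countB-∷-false p y xs py))
  by-cases false true  px py _ = trans (countB-∷-false p x _ px) (countB-∷-true p y xs py)

crosses-path : ∀ {n} (X : Subset n) v a b → crosses X (v , a) xor crosses X (v , b) ≡ crosses X (a , b)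
crosses-path X v a b = xor-cancelˡ (inB v X) (inB a X) (inB b X)

DeletesShortPath : ∀ {n} → Fin n → Fin n → List (Edge n) → List (Edge n) → Set
DeletesShortPath a b E E' =
  DelEdge a b E E' ⊎ ∃₂ λ v E₁ → DelEdge v a E E₁ × DelEdge v b E₁ E'

deletionStep⇒deletesShortPath : ∀ {n} {G G' : Graph n} {A B} → DeletionStep G A B G' →
  ∃₂ λ a b → a ∈ A × b ∈ B × DeletesShortPath a b (edges G) (edges G')
deletionStep⇒deletesShortPath (inj₁ (a , b , a∈A , b∈B , del)) =
  a , b , a∈A , b∈B , inj₁ del
deletionStep⇒deletesShortPath (inj₂ (a , b , v , a∈A , b∈B , _ , _ , E₁ , del₁ , del₂)) =
  a , b , a∈A , b∈B , inj₂ (v , E₁ , del₁ , del₂)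

countB-deletesShortPath-≤ : ∀ {n} (p : Edge n → Bool) {a b E E'} →
  DeletesShortPath a b E E' → countB p E' ≤ countB p E
countB-deletesShortPath-≤ p (inj₁ del) = countB-delEdge-≤ p del
countB-deletesShortPath-≤ p (inj₂ (_ , _ , del₁ , del₂)) =
  ≤-trans (countB-delEdge-≤ p del₂) (countB-delEdge-≤ p del₁)

crosses-deletesShortPath : ∀ {n} (X : Subset n) {a b E E'} → crosses X (a , b) ≡ true →
  DeletesShortPath a b E E' → countB (crosses X) E ≡ suc (countB (crosses X) E')
crosses-deletesShortPath X {a} {b} {E' = E'} ab (inj₁ del) =
  trans (countB-delEdge (crosses X) (crosses-sym X) a b del) (countB-∷-true (crosses X) (a , b) E' ab)
crosses-deletesShortPath X {a} {b} {E} {E'} ab (inj₂ (v , E₁ , del₁ , del₂)) = begin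
  countB (crosses X) E                         ≡⟨ countB-delEdge (crosses X) (crosses-sym X) v a del₁ ⟩
  countB (crosses X) ((v , a) ∷ E₁)            ≡⟨ countB-∷-congʳ (crosses X) (v , a)
                                                    (countB-delEdge (crosses X) (crosses-sym X) v b del₂) ⟩
  countB (crosses X) ((v , a) ∷ (v , b) ∷ E')  ≡⟨ countB-∷-∷-xor (crosses X) (v , a) (v , b) E'
                                                    (trans (crosses-path X v a b) ab) ⟩
  suc (countB (crosses X) E')                  ∎
  where open ≡-Reasoning

fromℚᵘ-homo-+ : ∀ p q → fromℚᵘ (p ℚᵘ.+ q) ≡ fromℚᵘ p ℚ.+ fromℚᵘ q
fromℚᵘ-homo-+ p q = toℚᵘ-injective (begin
  toℚᵘ (fromℚᵘ (p ℚᵘ.+ q))              ≈⟨ toℚᵘ-fromℚᵘ (p ℚᵘ.+ q) ⟩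
  p ℚᵘ.+ q                              ≈⟨ ℚᵘ.+-cong (toℚᵘ-fromℚᵘ p) (toℚᵘ-fromℚᵘ q) ⟨
  toℚᵘ (fromℚᵘ p) ℚᵘ.+ toℚᵘ (fromℚᵘ q)  ≈⟨ toℚᵘ-homo-+ (fromℚᵘ p) (fromℚᵘ q) ⟨
  toℚᵘ (fromℚᵘ p ℚ.+ fromℚᵘ q)          ∎)
  where open import Relation.Binary.Reasoning.Setoid ℚᵘ.≃-setoid

2+m/2≡m/2+1 : ∀ m → + (2 ℕ.+ m) / 2 ≡ + m / 2 ℚ.+ 1ℚ
2+m/2≡m/2+1 m = begin
  + (2 ℕ.+ m) / 2                  ≡⟨ fromℚᵘ-cong {mkℚᵘ (+ (2 ℕ.+ m)) 1} {mkℚᵘ (+ m) 1 ℚᵘ.+ ℚᵘ.1ℚᵘ}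
                                        (*≡* (trans (cong (ℤ._* + 2) (pos-+ 2 m)) (ring (+ m)))) ⟩
  fromℚᵘ (mkℚᵘ (+ m) 1 ℚᵘ.+ ℚᵘ.1ℚᵘ)  ≡⟨ fromℚᵘ-homo-+ (mkℚᵘ (+ m) 1) ℚᵘ.1ℚᵘ ⟩
  + m / 2 ℚ.+ 1ℚ                   ∎
  where
  open ≡-Reasoning
  ring : ∀ i → (+ 2 ℤ.+ i) ℤ.* + 2 ≡ (i ℤ.* + 1 ℤ.+ + 1 ℤ.* + 2) ℤ.* + 2
  ring = solve-∀

[k-1]/1≡k/1-1 : ∀ k → (k - + 1) / 1 ≡ k / 1 ℚ.- 1ℚ
[k-1]/1≡k/1-1 k = begin
  (k - + 1) / 1                    ≡⟨ fromℚᵘ-cong {mkℚᵘ (k - + 1) 0} {mkℚᵘ k 0 ℚᵘ.- ℚᵘ.1ℚᵘ} (*≡* (ring k)) ⟩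
  fromℚᵘ (mkℚᵘ k 0 ℚᵘ.- ℚᵘ.1ℚᵘ)    ≡⟨ fromℚᵘ-homo-+ (mkℚᵘ k 0) (ℚᵘ.- ℚᵘ.1ℚᵘ) ⟩
  k / 1 ℚ.- 1ℚ                     ∎
  where
  open ≡-Reasoning
  ring : ∀ i → (i - + 1) ℤ.* + 1 ≡ (i ℤ.* + 1 ℤ.+ ℤ.- + 1 ℤ.* + 1) ℤ.* + 1
  ring = solve-∀

module _ where
  open ℚ-Solver.+-*-Solver

  +-1-cancelʳ : ∀ p → p ℚ.+ 1ℚ ℚ.- 1ℚ ≡ p
  +-1-cancelʳ = solve 1 (λ p → p :+ con 1ℚ :- con 1ℚ := p) refl

  -1+1-cancelʳ : ∀ p → p ℚ.- 1ℚ ℚ.+ 1ℚ ≡ p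
  -1+1-cancelʳ = solve 1 (λ p → p :- con 1ℚ :+ con 1ℚ := p) refl

  μ-shift : ∀ at t av K c ak →
    at ℚ.* t ℚ.+ av ℚ.* ((K ℚ.- 1ℚ) ℚ.- c) ℚ.+ ak ℚ.* (K ℚ.- 1ℚ)
    ≡ at ℚ.* t ℚ.+ av ℚ.* (K ℚ.- (c ℚ.+ 1ℚ)) ℚ.+ ak ℚ.* K ℚ.- ak
  μ-shift = solve 6 (λ at t av K c ak →
      at :* t :+ av :* ((K :- con 1ℚ) :- c) :+ ak :* (K :- con 1ℚ)
    := at :* t :+ av :* (K :- (c :+ con 1ℚ)) :+ ak :* K :- ak) refl

+1-cancelʳ-< : ∀ {p q} → p ℚ.+ 1ℚ ℚ.< q ℚ.+ 1ℚ → p ℚ.< q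
+1-cancelʳ-< {p} {q} h = subst₂ ℚ._<_ (+-1-cancelʳ p) (+-1-cancelʳ q) (+-monoˡ-< (ℚ.- 1ℚ) h)

+1≤⇔≤-1 : ∀ {p q} → p ℚ.+ 1ℚ ℚ.≤ q ⇔ p ℚ.≤ q ℚ.- 1ℚ
+1≤⇔≤-1 {p} {q} = mk⇔
  (λ h → subst₂ ℚ._≤_ (+-1-cancelʳ p) refl (+-monoˡ-≤ (ℚ.- 1ℚ) h))
  (λ h → subst₂ ℚ._≤_ refl (-1+1-cancelʳ q) (+-monoˡ-≤ 1ℚ h))

budget-shift : ∀ {c c'} k → c ≡ c' ℚ.+ 1ℚ → c ℚ.≤ k / 1 ⇔ c' ℚ.≤ (k - + 1) / 1
budget-shift k refl rewrite [k-1]/1≡k/1-1 k = +1≤⇔≤-1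

isInstance-deletesShortPath : ∀ {n} {G G' : Graph n} {T A B a b k k'} →
  DeletesShortPath a b (edges G) (edges G') → IsInstance G T A B k → IsInstance G' T A B k'
isInstance-deletesShortPath del inst = record
  { pairsDisjoint = pairsDisjoint
  ; termDeg       = All.map (≤-trans (countB-deletesShortPath-≤ _ del)) termDeg
  ; sep           = sep
  }
  where open IsInstance inst

module ShortPathDeletion {n} {G G' : Graph n} {A B : Subset n} {a b : Fin n}
         (a∈A : a ∈ A) (b∈B : b ∈ B) (del : DeletesShortPath a b (edges G) (edges G')) where

  cost-deletesShortPath : ∀ {X Y} → Disjoint X Y → Extends X Y A B → cost G X Y ≡ cost G' X Y ℚ.+ 1ℚ
  cost-deletesShortPath {X} {Y} X∩Y=∅ (A⊆X , B⊆Y) = begin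
    + (d G X ℕ.+ d G Y) / 2              ≡⟨ cong (λ m → + m / 2) d-drop ⟩
    + (2 ℕ.+ (d G' X ℕ.+ d G' Y)) / 2    ≡⟨ 2+m/2≡m/2+1 (d G' X ℕ.+ d G' Y) ⟩
    cost G' X Y ℚ.+ 1ℚ                   ∎
    where
    open ≡-Reasoning
    a∈X = A⊆X a∈A
    b∈Y = B⊆Y b∈B
    d-drop : d G X ℕ.+ d G Y ≡ 2 ℕ.+ (d G' X ℕ.+ d G' Y)
    d-drop = trans
      (cong₂ ℕ._+_
        (crosses-deletesShortPath X (∈∉⇒crosses a∈X (λ b∈X → X∩Y=∅ b b∈X b∈Y)) del)
        (crosses-deletesShortPath Y (trans (crosses-sym Y a b) (∈∉⇒crosses b∈Y (X∩Y=∅ a a∈X))) del))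
      (cong suc (+-suc (d G' X) (d G' Y)))

  maximal-deletesShortPath : ∀ {T} → Disjoint A B → Maximal G T A B → Maximal G' T A B
  maximal-deletesShortPath A∩B=∅ maximal X Y sep ext X,Y≢A,B = +1-cancelʳ-<
    (subst₂ ℚ._<_ (cost-deletesShortPath A∩B=∅ (⊆-refl , ⊆-refl)) (cost-deletesShortPath (proj₁ sep) ext)
      (maximal X Y sep ext X,Y≢A,B))

  solvable-deletesShortPath : ∀ {T k} → Solvable G T A B k ⇔ Solvable G' T A B (k - + 1)
  solvable-deletesShortPath {k = k} = mk⇔
    (λ (X , Y , sep , int , ext , ≤k) →
      X , Y , sep , int , ext , Equivalence.to (budget-shift k (cost-deletesShortPath (proj₁ sep) ext)) ≤k)
    (λ (X , Y , sep , int , ext , ≤k-1) →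
      X , Y , sep , int , ext , Equivalence.from (budget-shift k (cost-deletesShortPath (proj₁ sep) ext)) ≤k-1)

  μ-deletesShortPath : ∀ {T k} → Disjoint A B → μ G' T A B (k - + 1) ≡ μ G T A B k ℚ.- αk
  μ-deletesShortPath {T} {k} A∩B=∅ = begin
    αt ℚ.* t ℚ.+ αν ℚ.* ((k - + 1) / 1 ℚ.- c') ℚ.+ αk ℚ.* ((k - + 1) / 1)
      ≡⟨ cong (λ K → αt ℚ.* t ℚ.+ αν ℚ.* (K ℚ.- c') ℚ.+ αk ℚ.* K) ([k-1]/1≡k/1-1 k) ⟩
    αt ℚ.* t ℚ.+ αν ℚ.* ((k / 1 ℚ.- 1ℚ) ℚ.- c') ℚ.+ αk ℚ.* (k / 1 ℚ.- 1ℚ)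
      ≡⟨ μ-shift αt t αν (k / 1) c' αk ⟩
    αt ℚ.* t ℚ.+ αν ℚ.* (k / 1 ℚ.- (c' ℚ.+ 1ℚ)) ℚ.+ αk ℚ.* (k / 1) ℚ.- αk
      ≡⟨ cong (λ c → αt ℚ.* t ℚ.+ αν ℚ.* (k / 1 ℚ.- c) ℚ.+ αk ℚ.* (k / 1) ℚ.- αk)
              (sym (cost-deletesShortPath A∩B=∅ (⊆-refl , ⊆-refl))) ⟩
    αt ℚ.* t ℚ.+ αν ℚ.* (k / 1 ℚ.- cost G A B) ℚ.+ αk ℚ.* (k / 1) ℚ.- αk
      ∎
    where
    open ≡-Reasoning
    t  = + tI T A B / 1
    c' = cost G' A B

lemma3p2 : ∀ {n} (G G' : Graph n) (T : List (Pair n)) (A B : Subset n) (k : ℤ) →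
    IsInstance G T A B k → Maximal G T A B → DeletionStep G A B G' →
    IsInstance G' T A B (k - + 1) × Maximal G' T A B ×
    (Solvable G T A B k ⇔ Solvable G' T A B (k - + 1)) ×
    μ G' T A B (k - + 1) ≡ μ G T A B k Data.Rational.- αk
lemma3p2 G G' T A B k inst maximal step =
  let (a , b , a∈A , b∈B , del) = deletionStep⇒deletesShortPath {G = G} {G'} step
      open ShortPathDeletion {G = G} {G'} a∈A b∈B del
      A∩B=∅ = proj₁ (IsInstance.sep inst)
  in isInstance-deletesShortPath del inst
   , maximal-deletesShortPath A∩B=∅ maximal
   , solvable-deletesShortPath {T} {k}
   , μ-deletesShortPath {T} {k} A∩B=∅
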